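{- Let $k \ge 1$ and let $G$ be a graph with $n$ vertices. Suppose $G$ contains an induced subgraph $H$ with $2k$ vertices such that $H$ is a $k$-letter graph for a word of the form \[ w = \ell_1 \, \ell_2 \cdots \ell_k \, \ell_{\pi(1)} \, \ell_{\pi(2)} \cdots \ell_{\pi(k)} \] over the alphabet $\{\ell_1,\dots,\ell_k\}$, for some permutation $\pi$ of $\{1,\dots,k\}$ (that is, $H \cong \Gamma_{D_1}(w)$ for some decoder $D_1 \subseteq \{\ell_1,\dots,\ell_k\}^2$). Then $w$ can be extended to a lettering of $G$ by inserting new letters into the middle of $w$: there exist $n-2k$ distinct letters $\lambda_1,\dots,\lambda_{n-2k}$ not among $\ell_1,\dots,\ell_k$ and a decoder $D$ such that $G \cong \Gamma_D(\ell_1 \cdots \ell_k \, \lambda_1 \cdots \lambda_{n-2k} \, \ell_{\pi(1)} \cdots \ell_{\pi(k)})$. Consequently $\ell(G) \le n-k$.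
   Context: For a finite alphabet $\Sigma$, a decoder is a set $D \subseteq \Sigma^2$ of ordered pairs. For a word $w = w(1)w(2)\cdots w(n)$ with letters in $\Sigma$, the letter graph $\Gamma_D(w)$ is the graph with vertex set $\{1,\dots,n\}$ and an edge between $i<j$ exactly when $(w(i),w(j)) \in D$. If $|\Sigma| = k$, $\Gamma_D(w)$ is called a $k$-letter graph. A word $w$ is a lettering of a graph $G$ if $\Gamma_D(w)$ is isomorphic to $G$ for some decoder $D$. The lettericity $\ell(G)$ of a graph $G$ is the least integer $k$ such that $G$ is isomorphic to a $k$-letter graph. -}

module Defs where

open import Data.Nat using (ℕ; _+_; _<ᵇ_)
open import Data.Fin using (Fin; toℕ; splitAt; _↑ˡ_; _↑ʳ_)
open import Data.Fin.Permutation using (Permutation′; _⟨$⟩ʳ_)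
open import Data.Bool using (Bool; true; false; if_then_else_)
open import Data.Sum using (inj₁; inj₂)
open import Data.Product using (Σ)
open import Relation.Binary.PropositionalEquality using (_≡_)

record Graph (n : ℕ) : Set where
  field
    adj    : Fin n → Fin n → Bool
    sym    : ∀ i j → adj i j ≡ adj j i
    irrefl : ∀ i → adj i i ≡ false
open Graph public

-- Induced subgraph of G on the image of e (e is required injective where used).
induced : ∀ {n m} → Graph n → (Fin m → Fin n) → Fin m → Fin m → Bool
induced G e i j = adj G (e i) (e j)

record Iso {n m : ℕ} (A : Fin n → Fin n → Bool) (B : Fin m → Fin m → Bool) : Set where
  field
    to       : Fin n → Fin m
    from     : Fin m → Fin n
    from∘to  : ∀ i → from (to i) ≡ i
    to∘from  : ∀ j → to (from j) ≡ j
    preserve : ∀ i j → B (to i) (to j) ≡ A i j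

Decoder : ℕ → Set
Decoder k = Fin k → Fin k → Bool

Γ : ∀ {k m} → Decoder k → (Fin m → Fin k) → Fin m → Fin m → Bool
Γ D w i j =
  if toℕ i <ᵇ toℕ j then D (w i) (w j)
  else (if toℕ j <ᵇ toℕ i then D (w j) (w i) else false)

IsLetterGraph : ∀ {n} → Graph n → ℕ → Set
IsLetterGraph {n} G j = Σ (Decoder j) λ D → Σ (Fin n → Fin j) λ w → Iso (adj G) (Γ D w)

-- The word ℓ₁ ⋯ ℓ_k ℓ_{π(1)} ⋯ ℓ_{π(k)} over alphabet Fin k (ℓ_i = i).
word₀ : (k : ℕ) → Permutation′ k → Fin (k + k) → Fin k
word₀ k π i with splitAt k i
... | inj₁ x = x
... | inj₂ y = π ⟨$⟩ʳ y

-- The word ℓ₁ ⋯ ℓ_k λ₁ ⋯ λ_m ℓ_{π(1)} ⋯ ℓ_{π(k)} over alphabet Fin (k + m),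
-- with ℓ_i = i ↑ˡ m and the new distinct letters λ_j = k ↑ʳ j.
word₁ : (k m : ℕ) → Permutation′ k → Fin (k + m + k) → Fin (k + m)
word₁ k m π i with splitAt (k + m) i
... | inj₁ x with splitAt k x
...   | inj₁ a = a ↑ˡ m
...   | inj₂ b = k ↑ʳ b
word₁ k m π i | inj₂ y = (π ⟨$⟩ʳ y) ↑ˡ m

-- Put the 2k vertices of H at the outer positions of ℓ₁ ⋯ ℓ_k λ₁ ⋯ λ_m ℓ_{π(1)} ⋯ ℓ_{π(k)}
-- and the remaining m = n − 2k vertices, in any order, at the λ's.  Decode a pair of letters
-- (x, y) by the adjacency between the first occurrence of x and the last occurrence of y.
-- This is correct: for positions p < q, moving p to the first occurrence of its letter and q
-- to the last occurrence of its letter changes nothing unless both are outer positions, and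
-- then it keeps them in order and keeps their letters, hence (H being a letter graph) their
-- adjacency.
module Submission where

open import Defs hiding (sym)
open import Data.Nat as ℕ using (ℕ; zero; suc; _+_; _∸_; _≤_; _<ᵇ_)
open import Data.Nat.Properties as ℕ
  using (<⇒<ᵇ; <ᵇ-reflects-<; ≤⇒≯; <⇒≤; ≤-refl; <-≤-trans; m≤m+n; +-monoʳ-<; +-cancelˡ-<;
         +-assoc; +-comm; m+[n∸m]≡n; m+n∸m≡n; ≤-reflexive)
open import Data.Fin using (Fin; zero; suc; toℕ; _<_; splitAt; join; _↑ˡ_; _↑ʳ_)
open import Data.Fin.Properties
  using (toℕ-↑ˡ; toℕ-↑ʳ; toℕ<n; ↑ˡ-injective; splitAt-↑ˡ; splitAt-↑ʳ; splitAt⁻¹-↑ˡ;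
         splitAt⁻¹-↑ʳ; splitAt-join; join-splitAt; suc-injective; 0≢1+n; <-cmp; _≟_;
         injective⇒≤)
open import Data.Fin.Permutation
  using (Permutation; Permutation′; _⟨$⟩ʳ_; _⟨$⟩ˡ_; inverseˡ; inverseʳ; id; transpose; _∘ₚ_)
import Data.Fin.Permutation.Components as PC
open import Data.Bool using (Bool; true; false)
open import Data.Bool.Properties using (T-≡)
open import Data.Sum as Sum using (_⊎_; inj₁; inj₂)
open import Data.Sum.Properties using (inj₁-injective)
open import Data.Product using (Σ; ∃-syntax; _×_; _,_; proj₁; proj₂)
open import Data.Empty using (⊥-elim)
open import Function using (_∘_; Equivalence)
open import Function.Definitions using (Injective)
open import Relation.Nullary using (contradiction)
open import Relation.Nullary.Decidable using (dec-true; dec-false)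
open import Relation.Nullary.Reflects using (ofʸ)
open import Relation.Binary using (tri<; tri≈; tri>)
open import Relation.Binary.PropositionalEquality
  using (_≡_; _≢_; refl; sym; trans; cong; cong₂; subst; subst₂; module ≡-Reasoning)

<⇒<ᵇ≡true : ∀ {m n} → m ℕ.< n → (m <ᵇ n) ≡ true
<⇒<ᵇ≡true m<n = Equivalence.to T-≡ (<⇒<ᵇ m<n)

≤⇒<ᵇ≡false : ∀ {m n} → n ≤ m → (m <ᵇ n) ≡ false
≤⇒<ᵇ≡false {m} {n} n≤m with m <ᵇ n | <ᵇ-reflects-< m n
... | false | _       = refl
... | true  | ofʸ m<n = contradiction m<n (≤⇒≯ n≤m)

module _ {k a : ℕ} (D : Decoder k) (w : Fin a → Fin k) where

  Γ-< : ∀ {p q} → p < q → Γ D w p q ≡ D (w p) (w q)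
  Γ-< p<q rewrite <⇒<ᵇ≡true p<q = refl

  Γ-> : ∀ {p q} → q < p → Γ D w p q ≡ D (w q) (w p)
  Γ-> q<p rewrite ≤⇒<ᵇ≡false (<⇒≤ q<p) | <⇒<ᵇ≡true q<p = refl

  Γ-irrefl : ∀ p → Γ D w p p ≡ false
  Γ-irrefl p rewrite ≤⇒<ᵇ≡false (≤-refl {toℕ p}) = refl

  Γ≡-fromOrdered : (A : Fin a → Fin a → Bool) → (∀ p q → A p q ≡ A q p) → (∀ p → A p p ≡ false)
      → (∀ p q → p < q → D (w p) (w q) ≡ A p q) → ∀ p q → Γ D w p q ≡ A p q
  Γ≡-fromOrdered A A-sym A-irrefl ordered p q with <-cmp p q
  ... | tri< p<q _ _ = trans (Γ-< p<q) (ordered p q p<q)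
  ... | tri> _ _ q<p = trans (Γ-> q<p) (trans (ordered q p q<p) (A-sym q p))
  ... | tri≈ _ refl _ = trans (Γ-irrefl p) (sym (A-irrefl p))

transpose-source : ∀ {n} (i j : Fin n) → PC.transpose i j i ≡ j
transpose-source i j rewrite dec-true (i ≟ i) refl = refl

transpose-fixed : ∀ {n} {i j l : Fin n} → l ≢ i → l ≢ j → PC.transpose i j l ≡ l
transpose-fixed {i = i} {j} {l} l≢i l≢j rewrite dec-false (l ≟ i) l≢i | dec-false (l ≟ j) l≢j = refl

injections-differ-by-permutation : ∀ {a n} (g f : Fin a → Fin n)
  → Injective _≡_ _≡_ g → Injective _≡_ _≡_ f
  → Σ (Permutation′ n) λ σ → ∀ i → σ ⟨$⟩ʳ g i ≡ f i
injections-differ-by-permutation {zero} g f _ _ = id , λ ()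
injections-differ-by-permutation {suc a} {n} g f g-inj f-inj =
  σ ∘ₚ transpose (σ ⟨$⟩ʳ g zero) (f zero) , agrees
  where
  rest : Σ (Permutation′ n) λ σ → ∀ i → σ ⟨$⟩ʳ g (suc i) ≡ f (suc i)
  rest = injections-differ-by-permutation (g ∘ suc) (f ∘ suc)
           (suc-injective ∘ g-inj) (suc-injective ∘ f-inj)

  σ : Permutation′ n
  σ = proj₁ rest

  agrees : ∀ i → PC.transpose (σ ⟨$⟩ʳ g zero) (f zero) (σ ⟨$⟩ʳ g i) ≡ f i
  agrees zero    = transpose-source (σ ⟨$⟩ʳ g zero) (f zero)
  agrees (suc i) = trans (cong (PC.transpose _ _) (proj₂ rest i))
                         (transpose-fixed ≢σg₀ (0≢1+n ∘ f-inj ∘ sym))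
    where
    ≢σg₀ : f (suc i) ≢ σ ⟨$⟩ʳ g zero
    ≢σg₀ eq = 0≢1+n (g-inj (begin
      g zero                           ≡⟨ inverseˡ σ ⟨
      σ ⟨$⟩ˡ (σ ⟨$⟩ʳ g zero)           ≡⟨ cong (σ ⟨$⟩ˡ_) (trans (sym eq) (sym (proj₂ rest i))) ⟩
      σ ⟨$⟩ˡ (σ ⟨$⟩ʳ g (suc i))        ≡⟨ inverseˡ σ ⟩
      g (suc i)                        ∎))
      where open ≡-Reasoning

injections-differ-by-bijection : ∀ {a m n} → m ≡ n → (g : Fin a → Fin m) (f : Fin a → Fin n)
  → Injective _≡_ _≡_ g → Injective _≡_ _≡_ f
  → Σ (Permutation m n) λ σ → ∀ i → σ ⟨$⟩ʳ g i ≡ f i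
injections-differ-by-bijection refl = injections-differ-by-permutation

Iso-fromPermutation : ∀ {m n} {A : Fin n → Fin n → Bool} {B : Fin m → Fin m → Bool}
  (σ : Permutation m n) → (∀ p q → B p q ≡ A (σ ⟨$⟩ʳ p) (σ ⟨$⟩ʳ q)) → Iso A B
Iso-fromPermutation {A = A} σ B≡A = record
  { to       = σ ⟨$⟩ˡ_
  ; from     = σ ⟨$⟩ʳ_
  ; from∘to  = λ _ → inverseʳ σ
  ; to∘from  = λ _ → inverseˡ σ
  ; preserve = λ i j → trans (B≡A _ _) (cong₂ A (inverseʳ σ) (inverseʳ σ))
  }

IsLetterGraph-fromIso : ∀ {n l K} (G : Graph n) (D : Decoder K) (w : Fin l → Fin K)
  → l ≡ n → Iso (adj G) (Γ D w) → IsLetterGraph G K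
IsLetterGraph-fromIso G D w refl G≅ = D , w , G≅

↑ˡ-mono-< : ∀ {m} n {i j : Fin m} → i < j → i ↑ˡ n < j ↑ˡ n
↑ˡ-mono-< n {i} {j} = subst₂ ℕ._<_ (sym (toℕ-↑ˡ i n)) (sym (toℕ-↑ˡ j n))

↑ˡ-cancel-< : ∀ {m} n {i j : Fin m} → i ↑ˡ n < j ↑ˡ n → i < j
↑ˡ-cancel-< n {i} {j} = subst₂ ℕ._<_ (toℕ-↑ˡ i n) (toℕ-↑ˡ j n)

↑ʳ-mono-< : ∀ m {n} {i j : Fin n} → i < j → m ↑ʳ i < m ↑ʳ j
↑ʳ-mono-< m {i = i} {j} = subst₂ ℕ._<_ (sym (toℕ-↑ʳ m i)) (sym (toℕ-↑ʳ m j)) ∘ +-monoʳ-< m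

↑ʳ-cancel-< : ∀ m {n} {i j : Fin n} → m ↑ʳ i < m ↑ʳ j → i < j
↑ʳ-cancel-< m {i = i} {j} = +-cancelˡ-< m _ _ ∘ subst₂ ℕ._<_ (toℕ-↑ʳ m i) (toℕ-↑ʳ m j)

↑ˡ<↑ʳ : ∀ {m n} (i : Fin m) (j : Fin n) → i ↑ˡ n < m ↑ʳ j
↑ˡ<↑ʳ {m} {n} i j =
  subst₂ ℕ._<_ (sym (toℕ-↑ˡ i n)) (sym (toℕ-↑ʳ m j)) (<-≤-trans (toℕ<n i) (m≤m+n m (toℕ j)))

module Insertion (k m : ℕ) (π : Permutation′ k) where

  data Slot : Fin (k + m + k) → Set where
    left  : (a : Fin k) → Slot ((a ↑ˡ m) ↑ˡ k)
    mid   : (j : Fin m) → Slot ((k ↑ʳ j) ↑ˡ k)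
    right : (y : Fin k) → Slot ((k + m) ↑ʳ y)

  slot : ∀ p → Slot p
  slot p with splitAt (k + m) p in p≡
  ... | inj₂ y = subst Slot (splitAt⁻¹-↑ʳ p≡) (right y)
  ... | inj₁ x with splitAt k x in x≡
  ...   | inj₁ a = subst Slot (trans (cong (_↑ˡ k) (splitAt⁻¹-↑ˡ x≡)) (splitAt⁻¹-↑ˡ p≡)) (left a)
  ...   | inj₂ j = subst Slot (trans (cong (_↑ˡ k) (splitAt⁻¹-↑ʳ x≡)) (splitAt⁻¹-↑ˡ p≡)) (mid j)

  left<mid : ∀ a j → (a ↑ˡ m) ↑ˡ k < (k ↑ʳ j) ↑ˡ k
  left<mid a j = ↑ˡ-mono-< k (↑ˡ<↑ʳ a j)

  -- The positions of word₀ k π, placed at the two ends.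
  outer : Fin (k + k) → Fin (k + m + k)
  outer = join (k + m) k ∘ Sum.map₁ (_↑ˡ m) ∘ splitAt k

  outer-↑ˡ : ∀ a → outer (a ↑ˡ k) ≡ (a ↑ˡ m) ↑ˡ k
  outer-↑ˡ a rewrite splitAt-↑ˡ k a k = refl

  outer-↑ʳ : ∀ y → outer (k ↑ʳ y) ≡ (k + m) ↑ʳ y
  outer-↑ʳ y rewrite splitAt-↑ʳ k k y = refl

  outer-injective : Injective _≡_ _≡_ outer
  outer-injective {r} {s} eq = begin
    r                         ≡⟨ join-splitAt k k r ⟨
    join k k (splitAt k r)    ≡⟨ cong (join k k) (map₁-↑ˡ-injective (splitAt k r) (splitAt k s) split-eq) ⟩
    join k k (splitAt k s)    ≡⟨ join-splitAt k k s ⟩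
    s                         ∎
    where
    open ≡-Reasoning
    split-eq : Sum.map₁ (_↑ˡ m) (splitAt k r) ≡ Sum.map₁ (_↑ˡ m) (splitAt k s)
    split-eq = trans (sym (splitAt-join (k + m) k _)) (trans (cong (splitAt (k + m)) eq) (splitAt-join (k + m) k _))

    map₁-↑ˡ-injective : ∀ (x y : Fin k ⊎ Fin k) → Sum.map₁ (_↑ˡ m) x ≡ Sum.map₁ (_↑ˡ m) y → x ≡ y
    map₁-↑ˡ-injective (inj₁ a) (inj₁ b) e = cong inj₁ (↑ˡ-injective m a b (inj₁-injective e))
    map₁-↑ˡ-injective (inj₂ y) (inj₂ z) refl = refl

  word₀-↑ˡ : ∀ a → word₀ k π (a ↑ˡ k) ≡ a
  word₀-↑ˡ a rewrite splitAt-↑ˡ k a k = refl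

  word₀-↑ʳ : ∀ y → word₀ k π (k ↑ʳ y) ≡ π ⟨$⟩ʳ y
  word₀-↑ʳ y rewrite splitAt-↑ʳ k k y = refl

  word₁-left : ∀ a → word₁ k m π ((a ↑ˡ m) ↑ˡ k) ≡ a ↑ˡ m
  word₁-left a rewrite splitAt-↑ˡ (k + m) (a ↑ˡ m) k | splitAt-↑ˡ k a m = refl

  word₁-mid : ∀ j → word₁ k m π ((k ↑ʳ j) ↑ˡ k) ≡ k ↑ʳ j
  word₁-mid j rewrite splitAt-↑ˡ (k + m) (k ↑ʳ j) k | splitAt-↑ʳ k m j = refl

  word₁-right : ∀ y → word₁ k m π ((k + m) ↑ʳ y) ≡ (π ⟨$⟩ʳ y) ↑ˡ m
  word₁-right y rewrite splitAt-↑ʳ (k + m) k y = refl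

  lastOccurrence : Fin (k + m) → Fin (k + m + k)
  lastOccurrence x with splitAt k x
  ... | inj₁ a = (k + m) ↑ʳ (π ⟨$⟩ˡ a)
  ... | inj₂ j = (k ↑ʳ j) ↑ˡ k

  lastOccurrence-↑ˡ : ∀ a → lastOccurrence (a ↑ˡ m) ≡ (k + m) ↑ʳ (π ⟨$⟩ˡ a)
  lastOccurrence-↑ˡ a rewrite splitAt-↑ˡ k a m = refl

  lastOccurrence-↑ʳ : ∀ j → lastOccurrence (k ↑ʳ j) ≡ (k ↑ʳ j) ↑ˡ k
  lastOccurrence-↑ʳ j rewrite splitAt-↑ʳ k m j = refl

  -- x ↑ˡ k is the first occurrence of the letter x in word₁ k m π.
  decoder : (Fin (k + m + k) → Fin (k + m + k) → Bool) → Decoder (k + m)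
  decoder A x y = A (x ↑ˡ k) (lastOccurrence y)

  module _ (D₁ : Decoder k) (A : Fin (k + m + k) → Fin (k + m + k) → Bool)
           (A-outer : ∀ r s → A (outer r) (outer s) ≡ Γ D₁ (word₀ k π) r s) where
    open ≡-Reasoning

    A-outer-< : ∀ {r s} → r < s → A (outer r) (outer s) ≡ D₁ (word₀ k π r) (word₀ k π s)
    A-outer-< r<s = trans (A-outer _ _) (Γ-< D₁ (word₀ k π) r<s)

    A-left-right : ∀ a y → A ((a ↑ˡ m) ↑ˡ k) ((k + m) ↑ʳ y) ≡ D₁ a (π ⟨$⟩ʳ y)
    A-left-right a y = begin
      A ((a ↑ˡ m) ↑ˡ k) ((k + m) ↑ʳ y)          ≡⟨ cong₂ A (outer-↑ˡ a) (outer-↑ʳ y) ⟨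
      A (outer (a ↑ˡ k)) (outer (k ↑ʳ y))       ≡⟨ A-outer-< (↑ˡ<↑ʳ a y) ⟩
      D₁ (word₀ k π (a ↑ˡ k)) (word₀ k π (k ↑ʳ y)) ≡⟨ cong₂ D₁ (word₀-↑ˡ a) (word₀-↑ʳ y) ⟩
      D₁ a (π ⟨$⟩ʳ y)                           ∎

    A-left-left : ∀ {a b} → a < b → A ((a ↑ˡ m) ↑ˡ k) ((b ↑ˡ m) ↑ˡ k) ≡ D₁ a b
    A-left-left {a} {b} a<b = begin
      A ((a ↑ˡ m) ↑ˡ k) ((b ↑ˡ m) ↑ˡ k)         ≡⟨ cong₂ A (outer-↑ˡ a) (outer-↑ˡ b) ⟨
      A (outer (a ↑ˡ k)) (outer (b ↑ˡ k))       ≡⟨ A-outer-< (↑ˡ-mono-< k a<b) ⟩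
      D₁ (word₀ k π (a ↑ˡ k)) (word₀ k π (b ↑ˡ k)) ≡⟨ cong₂ D₁ (word₀-↑ˡ a) (word₀-↑ˡ b) ⟩
      D₁ a b                                    ∎

    A-right-right : ∀ {y z} → y < z → A ((k + m) ↑ʳ y) ((k + m) ↑ʳ z) ≡ D₁ (π ⟨$⟩ʳ y) (π ⟨$⟩ʳ z)
    A-right-right {y} {z} y<z = begin
      A ((k + m) ↑ʳ y) ((k + m) ↑ʳ z)           ≡⟨ cong₂ A (outer-↑ʳ y) (outer-↑ʳ z) ⟨
      A (outer (k ↑ʳ y)) (outer (k ↑ʳ z))       ≡⟨ A-outer-< (↑ʳ-mono-< k y<z) ⟩
      D₁ (word₀ k π (k ↑ʳ y)) (word₀ k π (k ↑ʳ z)) ≡⟨ cong₂ D₁ (word₀-↑ʳ y) (word₀-↑ʳ z) ⟩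
      D₁ (π ⟨$⟩ʳ y) (π ⟨$⟩ʳ z)                  ∎

    decoder-ordered : ∀ p q → p < q → decoder A (word₁ k m π p) (word₁ k m π q) ≡ A p q
    decoder-ordered p q p<q with slot p | slot q
    ... | left a | left b
      rewrite word₁-left a | word₁-left b | lastOccurrence-↑ˡ b =
        trans (A-left-right a _)
              (trans (cong (D₁ a) (inverseʳ π)) (sym (A-left-left (↑ˡ-cancel-< m (↑ˡ-cancel-< k p<q)))))
    ... | left a | mid j
      rewrite word₁-left a | word₁-mid j | lastOccurrence-↑ʳ j = refl
    ... | left a | right z
      rewrite word₁-left a | word₁-right z | lastOccurrence-↑ˡ (π ⟨$⟩ʳ z) | inverseˡ π {z} = refl
    ... | mid j | left a = ⊥-elim (ℕ.<-asym p<q (left<mid a j))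
    ... | mid i | mid j
      rewrite word₁-mid i | word₁-mid j | lastOccurrence-↑ʳ j = refl
    ... | mid j | right z
      rewrite word₁-mid j | word₁-right z | lastOccurrence-↑ˡ (π ⟨$⟩ʳ z) | inverseˡ π {z} = refl
    ... | right y | left a = ⊥-elim (ℕ.<-asym p<q (↑ˡ<↑ʳ (a ↑ˡ m) y))
    ... | right y | mid j = ⊥-elim (ℕ.<-asym p<q (↑ˡ<↑ʳ (k ↑ʳ j) y))
    ... | right y | right z
      rewrite word₁-right y | word₁-right z | lastOccurrence-↑ˡ (π ⟨$⟩ʳ z) | inverseˡ π {z} =
        trans (A-left-right (π ⟨$⟩ʳ y) z) (sym (A-right-right (↑ʳ-cancel-< (k + m) p<q)))

proposition1 : (k n : ℕ) → 1 ≤ k → (G : Graph n)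
    → (e : Fin (k + k) → Fin n) → Injective _≡_ _≡_ e
    → (π : Permutation′ k) → (D₁ : Decoder k)
    → Iso (induced G e) (Γ D₁ (word₀ k π))
    → (Σ (Decoder (k + (n ∸ (k + k)))) λ D → Iso (adj G) (Γ D (word₁ k (n ∸ (k + k)) π)))
    × (∃[ j ] (j ≤ n ∸ k × IsLetterGraph G j))
proposition1 k n _ G e e-injective π D₁ H≅ =
  (D , G≅) , (k + m , k+m≤n∸k , IsLetterGraph-fromIso G D (word₁ k m π) length≡n G≅)
  where
  m : ℕ
  m = n ∸ (k + k)

  open Insertion k m π

  n≡k+[k+m] : n ≡ k + (k + m)
  n≡k+[k+m] = trans (sym (m+[n∸m]≡n (injective⇒≤ e-injective))) (+-assoc k k m)

  length≡n : k + m + k ≡ n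
  length≡n = trans (+-comm (k + m) k) (sym n≡k+[k+m])

  k+m≤n∸k : k + m ≤ n ∸ k
  k+m≤n∸k = ≤-reflexive (sym (trans (cong (_∸ k) n≡k+[k+m]) (m+n∸m≡n k (k + m))))

  f : Fin (k + k) → Fin n
  f = e ∘ Iso.from H≅

  f-injective : Injective _≡_ _≡_ f
  f-injective {r} {s} eq =
    trans (sym (Iso.to∘from H≅ r)) (trans (cong (Iso.to H≅) (e-injective eq)) (Iso.to∘from H≅ s))

  σ : Permutation (k + m + k) n
  σ = proj₁ (injections-differ-by-bijection length≡n outer f outer-injective f-injective)

  σ∘outer≡f : ∀ r → σ ⟨$⟩ʳ outer r ≡ f r
  σ∘outer≡f = proj₂ (injections-differ-by-bijection length≡n outer f outer-injective f-injective)

  A : Fin (k + m + k) → Fin (k + m + k) → Bool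
  A p q = adj G (σ ⟨$⟩ʳ p) (σ ⟨$⟩ʳ q)

  A-outer : ∀ r s → A (outer r) (outer s) ≡ Γ D₁ (word₀ k π) r s
  A-outer r s = trans (cong₂ (adj G) (σ∘outer≡f r) (σ∘outer≡f s))
    (trans (sym (Iso.preserve H≅ _ _)) (cong₂ (Γ D₁ (word₀ k π)) (Iso.to∘from H≅ r) (Iso.to∘from H≅ s)))

  D : Decoder (k + m)
  D = decoder A

  G≅ : Iso (adj G) (Γ D (word₁ k m π))
  G≅ = Iso-fromPermutation σ
         (Γ≡-fromOrdered D (word₁ k m π) A (λ _ _ → Graph.sym G _ _) (λ _ → irrefl G _) (decoder-ordered D₁ A A-outer))
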